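{- If $G$ is a circular interval graph, then $\chi_\ell(G)\le \Delta_2(G)+3$.
   Context: A circular interval graph is a graph $G$ whose vertex set is a finite set of distinct points on a circle $C$, together with a set $\mathcal{I}$ of arcs of $C$, such that two vertices are adjacent iff they both lie in some arc of $\mathcal{I}$. $\chi_\ell(G)$ is the list chromatic number. $\Delta_2(G)$ is the maximum, over distinct vertices $u,v$, of the number of common neighbors of $u$ and $v$. -}

module Defs where

open import Data.Nat using (ℕ; zero; suc; _+_; _≤_; _<ᵇ_; _≤ᵇ_; _⊔_; _≡ᵇ_)
open import Data.Bool using (Bool; true; false; _∧_; _∨_; not)
open import Data.Fin using (Fin; toℕ)
open import Data.Bool.ListAction using (any)
open import Data.List using (List; []; _∷_; filter; length; foldr; map; concatMap; allFin)
open import Data.List.Membership.Propositional using (_∈_)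
open import Data.List.Relation.Unary.Unique.Propositional using (Unique)
open import Data.Product using (Σ; _×_; _,_)
open import Relation.Binary.PropositionalEquality using (_≡_; _≢_)
open import Relation.Nullary.Decidable using (does)
open import Data.Bool.Properties using (T?)

-- The vertices are n distinct
-- points on a circle C, numbered 0,1,...,n-1 in their cyclic order.  An arc
-- of C meets the vertex set in a cyclic interval of this order, and every
-- cyclic interval arises from an arc; so an arc is recorded by the first
-- vertex `start` it contains and the number `len` of consecutive vertices
-- (in cyclic order) it contains: start, start+1, ..., start+len-1 (mod n).
-- (len ≥ n means the arc contains every vertex; len = 0 means none.)
record Arc (n : ℕ) : Set where
  constructor arc
  field
    start : Fin n
    len   : ℕ

inArc : ∀ {n} → Fin n → Arc n → Bool
inArc {n} v (arc s l) =
  ((toℕ s ≤ᵇ toℕ v) ∧ (toℕ v <ᵇ toℕ s + l)) ∨ (toℕ v + n <ᵇ toℕ s + l)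

record CircularIntervalGraph : Set where
  constructor cig
  field
    n    : ℕ
    arcs : List (Arc n)

open CircularIntervalGraph public

adj : (G : CircularIntervalGraph) → Fin (n G) → Fin (n G) → Bool
adj G u v = not (toℕ u ≡ᵇ toℕ v) ∧ any (λ a → inArc u a ∧ inArc v a) (arcs G)

commonNbrs : (G : CircularIntervalGraph) → Fin (n G) → Fin (n G) → ℕ
commonNbrs G u v = length (filter (λ w → T? (adj G u w ∧ adj G v w)) (allFin (n G)))

Δ₂ : CircularIntervalGraph → ℕ
Δ₂ G = foldr _⊔_ 0
  (concatMap (λ u → map (λ v → if′ (toℕ u ≡ᵇ toℕ v) then 0 else commonNbrs G u v)
                        (allFin (n G)))
             (allFin (n G)))
  where
  if′_then_else_ : Bool → ℕ → ℕ → ℕ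
  if′ true then a else b = a
  if′ false then a else b = b

Choosable : CircularIntervalGraph → ℕ → Set
Choosable G k =
  (L : Fin (n G) → List ℕ) →
  (∀ v → Unique (L v)) → (∀ v → length (L v) ≡ k) →
  Σ (Fin (n G) → ℕ) λ c →
    (∀ v → c v ∈ L v) × (∀ u v → adj G u v ≡ true → c u ≢ c v)

-- χ_ℓ(G) ≤ d  (χ_ℓ is the least k such that G is k-choosable)
ListChromaticAtMost : CircularIntervalGraph → ℕ → Set
ListChromaticAtMost G d = Σ ℕ λ k → k ≤ d × Choosable G k

-- Every set S of vertices contains a vertex with at most Δ₂ + 2 neighbours in S, so
-- greedy list colouring succeeds from lists of Δ₂ + 3 colours.  Call w behind x if some
-- arc contains both with w strictly before x, positions being measured clockwise from
-- the start of the arc.  Pick v ∈ S with the fewest vertices of S behind it, and let u be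
-- the first vertex of S after v clockwise.  Every vertex of S behind u, except v itself,
-- is behind v; as u has at least as many vertices of S behind it as v, at most one vertex
-- of S is behind v but not behind u.  Any other neighbour w ≠ u of v in S is a common
-- neighbour of u and v: if w lies after v in an arc containing both, that arc contains u,
-- and if w is behind u it is adjacent to u.  So v has at most 1 + 1 + Δ₂ neighbours in S.
module Submission where

open import Defs
open import Data.Nat using (_+_)

open import Data.Bool using (Bool; true; false; T; not; _∧_; if_then_else_)
open import Data.Bool.Properties using (T?; T-≡; T-∧; T-∨)
open import Data.Empty using (⊥; ⊥-elim)
open import Data.Fin as Fin using (Fin; toℕ)
open import Data.Fin.Properties using (toℕ<n; toℕ-injective)
open import Data.Fin.Subset using (Subset; ⊤; ⁅_⁆; _∩_; _∪_; _─_; _-_; _⊂_; ∣_∣; Nonempty)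
  renaming (_∈_ to _∈ₛ_; _⊆_ to _⊆ₛ_)
open import Data.Fin.Subset.Properties
  using ( ∈⊤; x∈⁅x⁆; ∣⁅x⁆∣≡1; ∣p∣≤∣x∷p∣; p⊆q⇒∣p∣≤∣q∣; x∈p∩q⁺; x∈p∩q⁻; x∈p∪q⁺; x∈p∪q⁻
        ; x∈p∧x∉q⇒x∈p─q; x∈p∧x≢y⇒x∈p-y; x∈p⇒p-x⊂p; nonempty?; Empty-unique; ∣⊥∣≡0)
  renaming (_∈?_ to _∈ₛ?_)
open import Data.Fin.Subset.Induction using (Acc; acc; ⊂-wellFounded)
open import Data.List using (List; _∷_; length; filter; map; foldr; concatMap; allFin)
import Data.List as List
open import Data.List.Extrema.Nat using (argmin; argmin-sel; f[argmin]≤f[xs])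
open import Data.List.Membership.Propositional using (_∈_; _∉_; find; lose)
open import Data.List.Membership.Propositional.Properties
  using (∈-filter⁺; ∈-filter⁻; ∈-allFin; ∈-map⁺; ∈-concatMap⁺)
open import Data.List.Properties using (filter-notAll; length-map; foldr-preservesᵒ)
import Data.List.Relation.Unary.All as All
open import Data.List.Relation.Unary.AllPairs using (_∷_)
open import Data.List.Relation.Unary.Any as Any using (Any; here; there)
open import Data.List.Relation.Unary.Any.Properties using (any⁺; any⁻)
open import Data.List.Relation.Unary.Unique.Propositional using (Unique)
open import Data.Nat
  using (ℕ; zero; suc; _∸_; _≤_; _<_; _⊔_; _≤ᵇ_; _≡ᵇ_; z≤n; s≤s; s≤s⁻¹; _≤?_; _<?_)
import Data.Nat as ℕ
open import Data.Nat.Properties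
open import Algebra.Properties.CommutativeSemigroup +-commutativeSemigroup using (xy∙z≈xz∙y)
open import Data.Product using (Σ; ∃; ∃-syntax; _×_; _,_; proj₁; proj₂; swap)
open import Data.Sum using (_⊎_; inj₁; inj₂; [_,_]′)
open import Data.Vec using ([]; _∷_; lookup; tabulate)
open import Data.Vec.Functional using (updateAt)
open import Data.Vec.Functional.Properties using (updateAt-updates; updateAt-minimal)
open import Data.Vec.Properties using (lookup∘tabulate; tabulate∘lookup; []=⇒lookup; lookup⇒[]=)
open import Function using (_∘_; const; _⇔_; mk⇔; Equivalence)
open import Level using (Level)
open import Relation.Binary.Definitions using (DecidableEquality; tri<; tri≈; tri>)
open import Relation.Binary.PropositionalEquality
  using (_≡_; _≢_; refl; sym; trans; cong; cong₂; subst)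
open import Relation.Nullary using (Dec; yes; no; ¬?)
open import Relation.Nullary.Decidable using (⌊_⌋; _×-dec_; toWitness; fromWitness; dec-false)
open import Relation.Nullary.Reflects using (ofʸ; ofⁿ)
open import Relation.Unary using (Pred; Decidable)

open Equivalence using (to; from)

private
  variable
    ℓ : Level
    m : ℕ

-- Clockwise distance on the cycle 0, 1, …, N - 1

clockwise : ∀ {N} → Fin N → Fin N → ℕ
clockwise {N} a b = if toℕ a ≤ᵇ toℕ b then toℕ b ∸ toℕ a else toℕ b + N ∸ toℕ a

Reaches : ℕ → ℕ → ℕ → ℕ → Set
Reaches N a D b = a + D ≡ b ⊎ a + D ≡ b + N

clockwise-reaches : ∀ {N} (a b : Fin N) → Reaches N (toℕ a) (clockwise a b) (toℕ b)
clockwise-reaches {N} a b with toℕ a ≤ᵇ toℕ b | ≤ᵇ-reflects-≤ (toℕ a) (toℕ b)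
... | true  | ofʸ a≤b = inj₁ (m+[n∸m]≡n a≤b)
... | false | ofⁿ _   = inj₂ (m+[n∸m]≡n (≤-trans (<⇒≤ (toℕ<n a)) (m≤n+m N (toℕ b))))

clockwise<N : ∀ {N} (a b : Fin N) → clockwise a b < N
clockwise<N {N} a b with toℕ a ≤ᵇ toℕ b | ≤ᵇ-reflects-≤ (toℕ a) (toℕ b)
... | true  | ofʸ _   = ≤-<-trans (m∸n≤m (toℕ b) (toℕ a)) (toℕ<n b)
... | false | ofⁿ a≰b = +-cancelˡ-< (toℕ a) _ _ (begin-strict
  toℕ a + (toℕ b + N ∸ toℕ a) ≡⟨ m+[n∸m]≡n (≤-trans (<⇒≤ (toℕ<n a)) (m≤n+m N (toℕ b))) ⟩
  toℕ b + N                   <⟨ +-monoˡ-< N (≰⇒> a≰b) ⟩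
  toℕ a + N                   ∎)
  where open ≤-Reasoning

reaches-unique : ∀ {N a b D E} → D < N → E < N → Reaches N a D b → Reaches N a E b → D ≡ E
reaches-unique _ _ (inj₁ p) (inj₁ q) = +-cancelˡ-≡ _ _ _ (trans p (sym q))
reaches-unique _ _ (inj₂ p) (inj₂ q) = +-cancelˡ-≡ _ _ _ (trans p (sym q))
reaches-unique {N} {a} {D = D} _ E<N (inj₁ p) (inj₂ q) = ⊥-elim (<⇒≱ E<N (begin
  N      ≤⟨ m≤n+m N D ⟩
  D + N  ≡⟨ +-cancelˡ-≡ a _ _ (trans (sym (+-assoc a D N)) (trans (cong (_+ N) p) (sym q))) ⟩
  _      ∎))
  where open ≤-Reasoning
reaches-unique D<N E<N p@(inj₂ _) q@(inj₁ _) = sym (reaches-unique E<N D<N q p)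

clockwise-unique : ∀ {N} {a b : Fin N} {D} → D < N → Reaches N (toℕ a) D (toℕ b) →
                   clockwise a b ≡ D
clockwise-unique {a = a} {b} D<N = reaches-unique (clockwise<N a b) D<N (clockwise-reaches a b)

clockwise-injective : ∀ {N} (s : Fin N) {x y : Fin N} → clockwise s x ≡ clockwise s y → x ≡ y
clockwise-injective {N} s {x} {y} sx≡sy = toℕ-injective (same-end (clockwise-reaches s x)
  (subst (λ D → Reaches N (toℕ s) D (toℕ y)) (sym sx≡sy) (clockwise-reaches s y)))
  where
  wraps-too-far : ∀ {b c} → b ≡ c + N → b < N → ⊥
  wraps-too-far refl b<N = <⇒≱ b<N (m≤n+m N _)
  same-end : ∀ {D} → Reaches N (toℕ s) D (toℕ x) → Reaches N (toℕ s) D (toℕ y) → toℕ x ≡ toℕ y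
  same-end (inj₁ p) (inj₁ q) = trans (sym p) q
  same-end (inj₂ p) (inj₂ q) = +-cancelʳ-≡ N _ _ (trans (sym p) q)
  same-end (inj₁ p) (inj₂ q) = ⊥-elim (wraps-too-far (trans (sym p) q) (toℕ<n x))
  same-end (inj₂ p) (inj₁ q) = ⊥-elim (wraps-too-far (trans (sym q) p) (toℕ<n y))

private
  shift : ∀ s X Z {p q} → s + X ≡ p → s + X + Z ≡ q → p + Z ≡ q
  shift s X Z refl e = e

  cancel-N : ∀ N x Z {y} → x + N + Z ≡ y + N → x + Z ≡ y
  cancel-N N x Z e = +-cancelʳ-≡ N _ _ (trans (xy∙z≈xz∙y x Z N) e)

clockwise-+ : ∀ {N} (s x y : Fin N) → clockwise s x ≤ clockwise s y →
              clockwise s x + clockwise x y ≡ clockwise s y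
clockwise-+ {N} s x y X≤Y = trans
  (cong (X +_) (clockwise-unique Z<N (reach (clockwise-reaches s x) (clockwise-reaches s y))))
  X+Z≡Y
  where
  X = clockwise s x
  Y = clockwise s y
  Z = Y ∸ X
  X+Z≡Y : X + Z ≡ Y
  X+Z≡Y = m+[n∸m]≡n X≤Y
  Z<N : Z < N
  Z<N = ≤-<-trans (m∸n≤m Y X) (clockwise<N s y)
  s+X+Z : ∀ {q} → toℕ s + Y ≡ q → toℕ s + X + Z ≡ q
  s+X+Z = trans (trans (+-assoc (toℕ s) X Z) (cong (toℕ s +_) X+Z≡Y))
  reach : Reaches N (toℕ s) X (toℕ x) → Reaches N (toℕ s) Y (toℕ y) → Reaches N (toℕ x) Z (toℕ y)
  reach (inj₁ p) (inj₁ q) = inj₁ (shift (toℕ s) X Z p (s+X+Z q))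
  reach (inj₁ p) (inj₂ q) = inj₂ (shift (toℕ s) X Z p (s+X+Z q))
  reach (inj₂ p) (inj₂ q) = inj₁ (cancel-N N (toℕ x) Z (shift (toℕ s) X Z p (s+X+Z q)))
  reach (inj₂ p) (inj₁ q) = ⊥-elim (<⇒≱ (toℕ<n y) (begin
    N              ≤⟨ m≤n+m N (toℕ x) ⟩
    toℕ x + N      ≤⟨ m≤m+n (toℕ x + N) Z ⟩
    toℕ x + N + Z  ≡⟨ shift (toℕ s) X Z p (s+X+Z q) ⟩
    toℕ y          ∎))
    where open ≤-Reasoning

clockwise-+-wrap : ∀ {N} (s x y : Fin N) → clockwise s y < clockwise s x →
                   clockwise s x + clockwise x y ≡ clockwise s y + N
clockwise-+-wrap {N} s x y Y<X = trans
  (cong (X +_) (clockwise-unique Z<N (reach (clockwise-reaches s x) (clockwise-reaches s y))))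
  X+Z≡Y+N
  where
  X = clockwise s x
  Y = clockwise s y
  Z = Y + N ∸ X
  X+Z≡Y+N : X + Z ≡ Y + N
  X+Z≡Y+N = m+[n∸m]≡n (≤-trans (<⇒≤ (clockwise<N s x)) (m≤n+m N Y))
  Z<N : Z < N
  Z<N = +-cancelˡ-< X _ _ (subst (_< X + N) (sym X+Z≡Y+N) (+-monoˡ-< N Y<X))
  s+X+Z : ∀ {q} → toℕ s + Y ≡ q → toℕ s + X + Z ≡ q + N
  s+X+Z refl =
    trans (+-assoc (toℕ s) X Z) (trans (cong (toℕ s +_) X+Z≡Y+N) (sym (+-assoc (toℕ s) Y N)))
  reach : Reaches N (toℕ s) X (toℕ x) → Reaches N (toℕ s) Y (toℕ y) → Reaches N (toℕ x) Z (toℕ y)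
  reach (inj₁ p) (inj₁ q) = inj₂ (shift (toℕ s) X Z p (s+X+Z q))
  reach (inj₂ p) (inj₁ q) = inj₁ (cancel-N N (toℕ x) Z (shift (toℕ s) X Z p (s+X+Z q)))
  reach (inj₂ p) (inj₂ q) = inj₂ (cancel-N N (toℕ x) Z (shift (toℕ s) X Z p (s+X+Z q)))
  reach (inj₁ p) (inj₂ q) = ⊥-elim (<⇒≱ (+-mono-< (toℕ<n x) Z<N) (begin
    N + N            ≤⟨ m≤n+m (N + N) (toℕ y) ⟩
    toℕ y + (N + N)  ≡⟨ +-assoc (toℕ y) N N ⟨
    toℕ y + N + N    ≡⟨ shift (toℕ s) X Z p (s+X+Z q) ⟨
    toℕ x + Z        ∎))
    where open ≤-Reasoning

clockwise-nearer-≤ : ∀ {N} (s : Fin N) {v u w : Fin N} → clockwise v u ≤ clockwise v w →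
                     clockwise s v < clockwise s w → clockwise s u ≤ clockwise s w
clockwise-nearer-≤ s {v} {u} {w} vu≤vw sv<sw with clockwise s v ≤? clockwise s u
... | no sv≰su = <⇒≤ (<-trans (≰⇒> sv≰su) sv<sw)
... | yes sv≤su = begin
  clockwise s u                  ≡⟨ clockwise-+ s v u sv≤su ⟨
  clockwise s v + clockwise v u  ≤⟨ +-monoʳ-≤ (clockwise s v) vu≤vw ⟩
  clockwise s v + clockwise v w  ≡⟨ clockwise-+ s v w (<⇒≤ sv<sw) ⟩
  clockwise s w                  ∎
  where open ≤-Reasoning

clockwise-nearer-between : ∀ {N} (s : Fin N) {v u w : Fin N} → clockwise v u ≤ clockwise v w →
                           u ≢ v → w ≢ v → clockwise s w < clockwise s u →
                           clockwise s w < clockwise s v × clockwise s v < clockwise s u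
clockwise-nearer-between {N} s {v} {u} {w} vu≤vw u≢v w≢v sw<su = sw<sv , sv<su
  where
  sw<sv : clockwise s w < clockwise s v
  sw<sv with <-cmp (clockwise s w) (clockwise s v)
  ... | tri< sw<sv _ _ = sw<sv
  ... | tri≈ _ sw≡sv _ = ⊥-elim (w≢v (clockwise-injective s sw≡sv))
  ... | tri> _ _ sv<sw = ⊥-elim (<⇒≱ sw<su (clockwise-nearer-≤ s vu≤vw sv<sw))
  sv<su : clockwise s v < clockwise s u
  sv<su with <-cmp (clockwise s v) (clockwise s u)
  ... | tri< sv<su _ _ = sv<su
  ... | tri≈ _ sv≡su _ = ⊥-elim (u≢v (clockwise-injective s (sym sv≡su)))
  ... | tri> _ _ su<sv = ⊥-elim (<⇒≱ sw<su (+-cancelʳ-≤ N _ _ (begin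
    clockwise s u + N              ≡⟨ clockwise-+-wrap s v u su<sv ⟨
    clockwise s v + clockwise v u  ≤⟨ +-monoʳ-≤ (clockwise s v) vu≤vw ⟩
    clockwise s v + clockwise v w  ≡⟨ clockwise-+-wrap s v w (<-trans sw<su su<sv) ⟩
    clockwise s w + N              ∎)))
    where open ≤-Reasoning

-- Finite subsets

∣p∪q∣≤∣p∣+∣q∣ : (p q : Subset m) → ∣ p ∪ q ∣ ≤ ∣ p ∣ + ∣ q ∣
∣p∪q∣≤∣p∣+∣q∣ []          []          = z≤n
∣p∪q∣≤∣p∣+∣q∣ (true ∷ p)  (y ∷ q)     =
  s≤s (≤-trans (∣p∪q∣≤∣p∣+∣q∣ p q) (+-monoʳ-≤ ∣ p ∣ (∣p∣≤∣x∷p∣ y q)))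
∣p∪q∣≤∣p∣+∣q∣ (false ∷ p) (true ∷ q)  =
  ≤-trans (s≤s (∣p∪q∣≤∣p∣+∣q∣ p q)) (≤-reflexive (sym (+-suc ∣ p ∣ ∣ q ∣)))
∣p∪q∣≤∣p∣+∣q∣ (false ∷ p) (false ∷ q) = ∣p∪q∣≤∣p∣+∣q∣ p q

∣p∣≡∣p∩q∣+∣p─q∣ : (p q : Subset m) → ∣ p ∣ ≡ ∣ p ∩ q ∣ + ∣ p ─ q ∣
∣p∣≡∣p∩q∣+∣p─q∣ []          []          = refl
∣p∣≡∣p∩q∣+∣p─q∣ (true ∷ p)  (true ∷ q)  = cong suc (∣p∣≡∣p∩q∣+∣p─q∣ p q)
∣p∣≡∣p∩q∣+∣p─q∣ (true ∷ p)  (false ∷ q) =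
  trans (cong suc (∣p∣≡∣p∩q∣+∣p─q∣ p q)) (sym (+-suc ∣ p ∩ q ∣ ∣ p ─ q ∣))
∣p∣≡∣p∩q∣+∣p─q∣ (false ∷ p) (true ∷ q)  = ∣p∣≡∣p∩q∣+∣p─q∣ p q
∣p∣≡∣p∩q∣+∣p─q∣ (false ∷ p) (false ∷ q) = ∣p∣≡∣p∩q∣+∣p─q∣ p q

∣p─q∣≤1 : {p q : Subset m} {x : Fin m} → ∣ p ∣ ≤ ∣ q ∣ → q ⊆ₛ p ∪ ⁅ x ⁆ → ∣ p ─ q ∣ ≤ 1
∣p─q∣≤1 {p = p} {q} {x} ∣p∣≤∣q∣ q⊆p∪x = +-cancelˡ-≤ ∣ p ∩ q ∣ _ _ (begin
  ∣ p ∩ q ∣ + ∣ p ─ q ∣  ≡⟨ ∣p∣≡∣p∩q∣+∣p─q∣ p q ⟨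
  ∣ p ∣                  ≤⟨ ∣p∣≤∣q∣ ⟩
  ∣ q ∣                  ≤⟨ p⊆q⇒∣p∣≤∣q∣ q⊆p∩q∪x ⟩
  ∣ p ∩ q ∪ ⁅ x ⁆ ∣      ≤⟨ ∣p∪q∣≤∣p∣+∣q∣ (p ∩ q) ⁅ x ⁆ ⟩
  ∣ p ∩ q ∣ + ∣ ⁅ x ⁆ ∣  ≡⟨ cong (∣ p ∩ q ∣ +_) (∣⁅x⁆∣≡1 x) ⟩
  ∣ p ∩ q ∣ + 1          ∎)
  where
  open ≤-Reasoning
  q⊆p∩q∪x : q ⊆ₛ p ∩ q ∪ ⁅ x ⁆
  q⊆p∩q∪x y∈q with x∈p∪q⁻ p ⁅ x ⁆ (q⊆p∪x y∈q)
  ... | inj₁ y∈p = x∈p∪q⁺ (inj₁ (x∈p∩q⁺ (y∈p , y∈q)))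
  ... | inj₂ y≡x = x∈p∪q⁺ (inj₂ y≡x)

∈-tabulate⇔ : {f : Fin m → Bool} {x : Fin m} → x ∈ₛ tabulate f ⇔ f x ≡ true
∈-tabulate⇔ {f = f} {x} = mk⇔
  (λ x∈ → trans (sym (lookup∘tabulate f x)) ([]=⇒lookup x∈))
  (λ fx → lookup⇒[]= x (tabulate f) (trans (lookup∘tabulate f x) fx))

length-filter-tabulate : ∀ {A : Set} (f : A → Bool) (g : Fin m → A) →
                         length (filter (T? ∘ f) (List.tabulate g)) ≡ ∣ tabulate (f ∘ g) ∣
length-filter-tabulate {m = zero}  f g = refl
length-filter-tabulate {m = suc m} f g with f (g Fin.zero)
... | true  = cong suc (length-filter-tabulate f (g ∘ Fin.suc))
... | false = length-filter-tabulate f (g ∘ Fin.suc)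

elements : Subset m → List (Fin m)
elements p = filter (T? ∘ lookup p) (allFin _)

length-elements : (p : Subset m) → length (elements p) ≡ ∣ p ∣
length-elements p =
  trans (length-filter-tabulate (lookup p) (λ x → x)) (cong ∣_∣ (tabulate∘lookup p))

∈-elements⁺ : {p : Subset m} {x : Fin m} → x ∈ₛ p → x ∈ elements p
∈-elements⁺ {p = p} {x} x∈p = ∈-filter⁺ (T? ∘ lookup p) (∈-allFin x) (from T-≡ ([]=⇒lookup x∈p))

∃-argmin : {P : Pred (Fin m) ℓ} → Decidable P → (f : Fin m → ℕ) → {x : Fin m} → P x →
           ∃[ v ] P v × (∀ {w} → P w → f v ≤ f w)
∃-argmin {P = P} P? f {x} Px =
  v , Pv , λ Pw → All.lookup (f[argmin]≤f[xs] x xs) (∈-filter⁺ P? (∈-allFin _) Pw)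
  where
  xs = filter P? (allFin _)
  v = argmin f x xs
  Pv : P v
  Pv = [ (λ v≡x → subst P (sym v≡x) Px) , proj₂ ∘ ∈-filter⁻ P? {xs = allFin _} ]′
         (argmin-sel f x xs)

-- Greedy list colouring

module _ {A : Set} (_≟_ : DecidableEquality A) where
  open import Data.List.Membership.DecPropositional _≟_ using (_∈?_)

  ∃-∉ : {xs ys : List A} → Unique xs → length ys < length xs → ∃[ x ] x ∈ xs × x ∉ ys
  ∃-∉ {x ∷ xs} {ys} (x∉xs ∷ xs-unique) ∣ys∣<∣x∷xs∣ with x ∈? ys
  ... | no x∉ys = x , here refl , x∉ys
  ... | yes x∈ys with ∃-∉ xs-unique ∣ys-x∣<∣xs∣
    where
    ∣ys-x∣<∣xs∣ : length (filter (¬? ∘ (x ≟_)) ys) < length xs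
    ∣ys-x∣<∣xs∣ = <-≤-trans (filter-notAll (¬? ∘ (x ≟_)) ys (Any.map (λ x≡y x≢y → x≢y x≡y) x∈ys))
                            (s≤s⁻¹ ∣ys∣<∣x∷xs∣)
  ... | z , z∈xs , z∉ys-x =
    z , there z∈xs , λ z∈ys → z∉ys-x (∈-filter⁺ (¬? ∘ (x ≟_)) z∈ys (All.lookup x∉xs z∈xs))

module _ {m : ℕ} (E : Fin m → Fin m → Bool) where

  neighbours : Fin m → Subset m
  neighbours v = tabulate (E v)

  Degenerate : ℕ → Set
  Degenerate K = (S : Subset m) → Nonempty S → ∃[ v ] v ∈ₛ S × ∣ S ∩ neighbours v ∣ ≤ K

module _ {m : ℕ} {E : Fin m → Fin m → Bool}
         (E-irrefl : ∀ v → E v v ≢ true) (E-sym : ∀ {u v} → E u v ≡ true → E v u ≡ true)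
         {K : ℕ} (L : Fin m → List ℕ) (L-unique : ∀ v → Unique (L v))
         (L-length : ∀ v → length (L v) ≡ suc K) where

  ListColouring : Subset m → (Fin m → ℕ) → Set
  ListColouring S c = (∀ {v} → v ∈ₛ S → c v ∈ L v) ×
                      (∀ {u w} → u ∈ₛ S → w ∈ₛ S → E u w ≡ true → c u ≢ c w)

  usedColours : (Fin m → ℕ) → Subset m → Fin m → List ℕ
  usedColours c S v = map c (elements (S ∩ neighbours E v))

  ∣usedColours∣<∣L∣ : ∀ {S v} (c : Fin m → ℕ) → ∣ S ∩ neighbours E v ∣ ≤ K →
                      length (usedColours c S v) < length (L v)
  ∣usedColours∣<∣L∣ {S} {v} c deg = begin-strict
    length (usedColours c S v)              ≡⟨ length-map c (elements (S ∩ neighbours E v)) ⟩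
    length (elements (S ∩ neighbours E v))  ≡⟨ length-elements (S ∩ neighbours E v) ⟩
    ∣ S ∩ neighbours E v ∣                  <⟨ s≤s deg ⟩
    suc K                                   ≡⟨ L-length v ⟨
    length (L v)                            ∎
    where open ≤-Reasoning

  extend : ∀ {S v} → v ∈ₛ S → ∣ S ∩ neighbours E v ∣ ≤ K →
           ∀ {c} → ListColouring (S - v) c → ∃ (ListColouring S)
  extend {S} {v} v∈S deg {c} (c∈L , c-proper)
    with ∃-∉ ℕ._≟_ (L-unique v) (∣usedColours∣<∣L∣ {S} c deg)
  ... | x , x∈Lv , x-unused = c′ , c′∈L , c′-proper
    where
    c′ : Fin m → ℕ
    c′ = updateAt c v (const x)

    c′v≡x : c′ v ≡ x
    c′v≡x = updateAt-updates v c

    c′w≡cw : ∀ {w} → w ≢ v → c′ w ≡ c w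
    c′w≡cw {w} = updateAt-minimal w v c

    x≢neighbour : ∀ {w} → w ∈ₛ S → E v w ≡ true → x ≢ c w
    x≢neighbour w∈S vw x≡cw = x-unused (subst (_∈ usedColours c S v) (sym x≡cw)
      (∈-map⁺ c (∈-elements⁺ (x∈p∩q⁺ (w∈S , from ∈-tabulate⇔ vw)))))

    c′∈L : ∀ {w} → w ∈ₛ S → c′ w ∈ L w
    c′∈L {w} w∈S with w Fin.≟ v
    ... | yes refl = subst (_∈ L v) (sym c′v≡x) x∈Lv
    ... | no w≢v   = subst (_∈ L w) (sym (c′w≡cw w≢v)) (c∈L (x∈p∧x≢y⇒x∈p-y w∈S w≢v))

    c′-proper : ∀ {u w} → u ∈ₛ S → w ∈ₛ S → E u w ≡ true → c′ u ≢ c′ w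
    c′-proper {u} {w} u∈S w∈S uw with u Fin.≟ v | w Fin.≟ v
    ... | yes refl | yes refl = ⊥-elim (E-irrefl v uw)
    ... | yes refl | no w≢v   = λ eq →
      x≢neighbour w∈S uw (trans (sym c′v≡x) (trans eq (c′w≡cw w≢v)))
    ... | no u≢v   | yes refl = λ eq →
      x≢neighbour u∈S (E-sym uw) (trans (sym c′v≡x) (trans (sym eq) (c′w≡cw u≢v)))
    ... | no u≢v   | no w≢v   = λ eq →
      c-proper (x∈p∧x≢y⇒x∈p-y u∈S u≢v) (x∈p∧x≢y⇒x∈p-y w∈S w≢v) uw
               (trans (sym (c′w≡cw u≢v)) (trans eq (c′w≡cw w≢v)))

  list-colour : Degenerate E K → ∀ S → Acc _⊂_ S → ∃ (ListColouring S)
  list-colour degenerate S (acc smaller) with nonempty? S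
  ... | no S-empty = const 0 , ⊥-elim ∘ S-empty ∘ (_ ,_) , ⊥-elim ∘ S-empty ∘ (_ ,_)
  ... | yes S-nonempty with degenerate S S-nonempty
  ... | v , v∈S , deg with list-colour degenerate (S - v) (smaller (x∈p⇒p-x⊂p v∈S))
  ... | c , c-colours = extend v∈S deg c-colours

  degenerate⇒choosable : Degenerate E K →
    Σ (Fin m → ℕ) λ c → (∀ v → c v ∈ L v) × (∀ u w → E u w ≡ true → c u ≢ c w)
  degenerate⇒choosable degenerate =
    let c , c∈L , c-proper = list-colour degenerate ⊤ (⊂-wellFounded ⊤)
    in c , (λ v → c∈L ∈⊤) , (λ u w → c-proper ∈⊤ ∈⊤)

-- Circular interval graphs

≤-foldr-⊔ : ∀ {x xs} → x ∈ xs → x ≤ foldr _⊔_ 0 xs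
≤-foldr-⊔ {x} {xs} x∈xs =
  foldr-preservesᵒ {P = x ≤_} (λ y z → [ m≤n⇒m≤n⊔o z , m≤n⇒m≤o⊔n y ]′) 0 xs
    (inj₂ (Any.map (λ { refl → ≤-refl }) x∈xs))

entry≤foldr-⊔ : ∀ {N} (f : Fin N → Fin N → ℕ) u v →
                f u v ≤ foldr _⊔_ 0 (concatMap (λ u → map (f u) (allFin N)) (allFin N))
entry≤foldr-⊔ {N} f u v = ≤-foldr-⊔ (∈-concatMap⁺ (λ u → map (f u) (allFin N))
  (Any.map (λ { refl → ∈-map⁺ (f u) (∈-allFin v) }) (∈-allFin u)))

-- Δ₂ is built from a conditional local to its definition; naming the entry function
-- lets `rewrite` evaluate that conditional.
Δ₂-as-max : ∀ G → Σ (Fin (n G) → Fin (n G) → ℕ) λ f →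
            Δ₂ G ≡ foldr _⊔_ 0 (concatMap (λ u → map (f u) (allFin (n G))) (allFin (n G)))
Δ₂-as-max G = _ , refl

Δ₂-entry : ∀ G → Fin (n G) → Fin (n G) → ℕ
Δ₂-entry G = proj₁ (Δ₂-as-max G)

Δ₂-entry≡commonNbrs : ∀ G {u v : Fin (n G)} → u ≢ v → Δ₂-entry G u v ≡ commonNbrs G u v
Δ₂-entry≡commonNbrs G {u} {v} u≢v rewrite dec-false (toℕ u ℕ.≟ toℕ v) (u≢v ∘ toℕ-injective) = refl

commonNbrs≤Δ₂ : ∀ G {u v : Fin (n G)} → u ≢ v → commonNbrs G u v ≤ Δ₂ G
commonNbrs≤Δ₂ G {u} {v} u≢v =
  subst (_≤ Δ₂ G) (Δ₂-entry≡commonNbrs G u≢v) (entry≤foldr-⊔ (Δ₂-entry G) u v)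

offset : ∀ {N} → Arc N → Fin N → ℕ
offset a = clockwise (Arc.start a)

Covers : ∀ {N} → Arc N → Fin N → Set
Covers a v = offset a v < Arc.len a

private
  <-+ˡ⇔ : ∀ {s D t l} → s + D ≡ t → t < s + l ⇔ D < l
  <-+ˡ⇔ {s} refl = mk⇔ (+-cancelˡ-< s _ _) (+-monoʳ-< s)

  T-not-≡ᵇ⇔ : ∀ {m n} → T (not (m ≡ᵇ n)) ⇔ m ≢ n
  T-not-≡ᵇ⇔ {m} {n} with m ≡ᵇ n in eq
  ... | true  = mk⇔ (λ ()) (λ m≢n → m≢n (≡ᵇ⇒≡ m n (subst T (sym eq) _)))
  ... | false = mk⇔ (λ _ m≡n → subst T eq (≡⇒≡ᵇ m n m≡n)) _

T-inArc⇔ : ∀ {N} {v : Fin N} {a : Arc N} → T (inArc v a) ⇔ Covers a v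
T-inArc⇔ {N} {v} {arc s l} with toℕ s ≤ᵇ toℕ v | ≤ᵇ-reflects-≤ (toℕ s) (toℕ v)
... | true  | ofʸ s≤v = mk⇔
  (to unwrapped ∘ [ <ᵇ⇒< _ _ , ≤-<-trans (m≤m+n (toℕ v) N) ∘ <ᵇ⇒< _ _ ]′ ∘ to T-∨)
  (from T-∨ ∘ inj₁ ∘ <⇒<ᵇ ∘ from unwrapped)
  where
  unwrapped : toℕ v < toℕ s + l ⇔ toℕ v ∸ toℕ s < l
  unwrapped = <-+ˡ⇔ (m+[n∸m]≡n s≤v)
... | false | ofⁿ _ = mk⇔ (to wrapped ∘ <ᵇ⇒< _ _) (<⇒<ᵇ ∘ from wrapped)
  where
  wrapped : toℕ v + N < toℕ s + l ⇔ toℕ v + N ∸ toℕ s < l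
  wrapped = <-+ˡ⇔ (m+[n∸m]≡n (≤-trans (<⇒≤ (toℕ<n s)) (m≤n+m N (toℕ v))))

SharedArc : (G : CircularIntervalGraph) → Fin (n G) → Fin (n G) → Set
SharedArc G u w = Any (λ a → Covers a u × Covers a w) (arcs G)

adj⇔ : ∀ G {u w : Fin (n G)} → adj G u w ≡ true ⇔ (u ≢ w × SharedArc G u w)
adj⇔ G {u} {w} = mk⇔
  (λ uw → let u≠w , shared = to (T-∧ {not (toℕ u ≡ᵇ toℕ w)}) (from T-≡ uw)
          in to T-not-≡ᵇ⇔ u≠w ∘ cong toℕ , Any.map (λ {a} → covers {a}) (any⁻ _ (arcs G) shared))
  (λ (u≢w , shared) → to T-≡ (from T-∧
    (from T-not-≡ᵇ⇔ (u≢w ∘ toℕ-injective) , any⁺ _ (Any.map (λ {a} → inArcs {a}) shared))))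
  where
  covers : ∀ {a} → T (inArc u a ∧ inArc w a) → Covers a u × Covers a w
  covers {a} t =
    let tu , tw = to (T-∧ {inArc u a}) t in to (T-inArc⇔ {a = a}) tu , to (T-inArc⇔ {a = a}) tw
  inArcs : ∀ {a} → Covers a u × Covers a w → T (inArc u a ∧ inArc w a)
  inArcs {a} (cu , cw) = from T-∧ (from (T-inArc⇔ {a = a}) cu , from (T-inArc⇔ {a = a}) cw)

adj-sym : ∀ G {u w : Fin (n G)} → adj G u w ≡ true → adj G w u ≡ true
adj-sym G uw = let u≢w , shared = to (adj⇔ G) uw in from (adj⇔ G) (u≢w ∘ sym , Any.map swap shared)

adj-irrefl : ∀ G (v : Fin (n G)) → adj G v v ≢ true
adj-irrefl G v vv = proj₁ (to (adj⇔ G) vv) refl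

module _ (G : CircularIntervalGraph) where
  private
    V = Fin (n G)

  -- Covers a w is implied: offset a w < offset a x < Arc.len a.
  Behind : V → V → Set
  Behind x w = Any (λ a → offset a w < offset a x × Covers a x) (arcs G)

  behind? : ∀ x w → Dec (Behind x w)
  behind? x w = Any.any? (λ a → offset a w <? offset a x ×-dec offset a x <? Arc.len a) (arcs G)

  behind⇒adj : ∀ {x w} → Behind x w → adj G x w ≡ true
  behind⇒adj {x} {w} behind =
    from (adj⇔ G) (x≢w , Any.map (λ (w<x , x∈a) → x∈a , <-trans w<x x∈a) behind)
    where
    x≢w : x ≢ w
    x≢w refl = let _ , w<w , _ = Any.satisfied behind in <-irrefl refl w<w

  behindSet : V → Subset (n G)
  behindSet x = tabulate (λ w → ⌊ behind? x w ⌋)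

  ∈-behindSet⇔ : ∀ {x w} → w ∈ₛ behindSet x ⇔ Behind x w
  ∈-behindSet⇔ {x} {w} =
    mk⇔ (toWitness {a? = behind? x w} ∘ from T-≡ ∘ to ∈-tabulate⇔)
        (from ∈-tabulate⇔ ∘ to T-≡ ∘ fromWitness)

  commonNeighbours : V → V → Subset (n G)
  commonNeighbours u v = tabulate (λ w → adj G u w ∧ adj G v w)

  ∣commonNeighbours∣≡commonNbrs : ∀ u v → ∣ commonNeighbours u v ∣ ≡ commonNbrs G u v
  ∣commonNeighbours∣≡commonNbrs u v =
    sym (length-filter-tabulate (λ w → adj G u w ∧ adj G v w) (λ w → w))

  module _ {S : Subset (n G)} {v u : V} (u∈S : u ∈ₛ S) (u≢v : u ≢ v)
           (u-next : ∀ {w} → w ∈ₛ S × w ≢ v → clockwise v u ≤ clockwise v w) where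

    behind-next⊆ : S ∩ behindSet u ⊆ₛ S ∩ behindSet v ∪ ⁅ v ⁆
    behind-next⊆ {w} w∈ with x∈p∩q⁻ S _ w∈ | w Fin.≟ v
    ... | _          | yes refl = x∈p∪q⁺ (inj₂ (x∈⁅x⁆ v))
    ... | w∈S , w∈Bu | no w≢v   = x∈p∪q⁺ (inj₁ (x∈p∩q⁺ (w∈S , from (∈-behindSet⇔ {v} {w})
      (Any.map (λ {a} → behind-v {a}) (to (∈-behindSet⇔ {u} {w}) w∈Bu)))))
      where
      behind-v : ∀ {a} → offset a w < offset a u × Covers a u → offset a w < offset a v × Covers a v
      behind-v {a} (w<u , u∈a) =
        let w<v , v<u = clockwise-nearer-between (Arc.start a) (u-next (w∈S , w≢v)) u≢v w≢v w<u
        in w<v , <-trans v<u u∈a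

    private
      common⁺ : ∀ {w} → adj G v w ≡ true → adj G u w ≡ true →
                w ∈ₛ (S ∩ behindSet v ─ S ∩ behindSet u) ∪ commonNeighbours v u
      common⁺ vw uw = x∈p∪q⁺ (inj₂ (from ∈-tabulate⇔ (cong₂ _∧_ vw uw)))

    neighbour-behind-or-common : ∀ {w} → w ∈ₛ S → u ≢ w → adj G v w ≡ true →
                                 w ∈ₛ (S ∩ behindSet v ─ S ∩ behindSet u) ∪ commonNeighbours v u
    neighbour-behind-or-common {w} w∈S u≢w vw with to (adj⇔ G) vw
    ... | v≢w , shared with find shared
    ... | a , a∈arcs , v∈a , w∈a with <-cmp (offset a v) (offset a w)
    ... | tri≈ _ v≡w _ = ⊥-elim (v≢w (clockwise-injective (Arc.start a) v≡w))
    ... | tri< v<w _ _ = common⁺ vw (from (adj⇔ G) (u≢w , lose a∈arcs (u∈a , w∈a)))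
      where
      u∈a : Covers a u
      u∈a = ≤-<-trans (clockwise-nearer-≤ (Arc.start a) (u-next (w∈S , v≢w ∘ sym)) v<w) w∈a
    ... | tri> _ _ w<v with behind? u w
    ... | yes w-behind-u = common⁺ vw (behind⇒adj w-behind-u)
    ... | no ¬w-behind-u = x∈p∪q⁺ (inj₁ (x∈p∧x∉q⇒x∈p─q
      (x∈p∩q⁺ (w∈S , from ∈-behindSet⇔ (lose a∈arcs (w<v , v∈a))))
      (¬w-behind-u ∘ to ∈-behindSet⇔ ∘ proj₂ ∘ x∈p∩q⁻ S _)))

    neighbours⊆ : S ∩ neighbours (adj G) v ⊆ₛ
                  ⁅ u ⁆ ∪ ((S ∩ behindSet v ─ S ∩ behindSet u) ∪ commonNeighbours v u)
    neighbours⊆ {w} w∈ with x∈p∩q⁻ S _ w∈ | u Fin.≟ w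
    ... | _          | yes refl = x∈p∪q⁺ (inj₁ (x∈⁅x⁆ u))
    ... | w∈S , w∈Nv | no u≢w   =
      x∈p∪q⁺ (inj₂ (neighbour-behind-or-common w∈S u≢w (to ∈-tabulate⇔ w∈Nv)))

    ∣neighbours∣≤2+commonNbrs : (∀ {x} → x ∈ₛ S → ∣ S ∩ behindSet v ∣ ≤ ∣ S ∩ behindSet x ∣) →
                                ∣ S ∩ neighbours (adj G) v ∣ ≤ 2 + commonNbrs G v u
    ∣neighbours∣≤2+commonNbrs v-min = begin
      ∣ S ∩ neighbours (adj G) v ∣   ≤⟨ p⊆q⇒∣p∣≤∣q∣ neighbours⊆ ⟩
      ∣ ⁅ u ⁆ ∪ ((Bv ─ Bu) ∪ C) ∣    ≤⟨ ∣p∪q∣≤∣p∣+∣q∣ ⁅ u ⁆ _ ⟩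
      ∣ ⁅ u ⁆ ∣ + ∣ (Bv ─ Bu) ∪ C ∣  ≤⟨ +-mono-≤ (≤-reflexive (∣⁅x⁆∣≡1 u))
                                                   (∣p∪q∣≤∣p∣+∣q∣ (Bv ─ Bu) C) ⟩
      1 + (∣ Bv ─ Bu ∣ + ∣ C ∣)      ≤⟨ +-monoʳ-≤ 1 (+-monoˡ-≤ ∣ C ∣
                                          (∣p─q∣≤1 (v-min u∈S) behind-next⊆)) ⟩
      2 + ∣ C ∣                      ≡⟨ cong (2 +_) (∣commonNeighbours∣≡commonNbrs v u) ⟩
      2 + commonNbrs G v u           ∎
      where
      open ≤-Reasoning
      Bv = S ∩ behindSet v
      Bu = S ∩ behindSet u
      C = commonNeighbours v u

  -- Taking the Dec as an argument instead of using `with` keeps Agda from normalising Δ₂ G.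
  few-neighbours : ∀ {S v} → (∀ {x} → x ∈ₛ S → ∣ S ∩ behindSet v ∣ ≤ ∣ S ∩ behindSet x ∣) →
                   Dec (Nonempty (S ∩ neighbours (adj G) v)) →
                   ∣ S ∩ neighbours (adj G) v ∣ ≤ 2 + Δ₂ G
  few-neighbours {S} {v} _ (no no-neighbours) =
    subst (_≤ 2 + Δ₂ G) (sym (trans (cong ∣_∣ (Empty-unique no-neighbours)) (∣⊥∣≡0 (n G)))) z≤n
  few-neighbours {S} {v} v-min (yes (w , w∈S∩Nv)) =
    let w∈S , w∈Nv = x∈p∩q⁻ S _ w∈S∩Nv
        w≢v = proj₁ (to (adj⇔ G) (to ∈-tabulate⇔ w∈Nv)) ∘ sym
        u , (u∈S , u≢v) , u-next =
          ∃-argmin (λ x → x ∈ₛ? S ×-dec ¬? (x Fin.≟ v)) (clockwise v) (w∈S , w≢v)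
    in ≤-trans (∣neighbours∣≤2+commonNbrs u∈S u≢v u-next v-min)
               (+-monoʳ-≤ 2 (commonNbrs≤Δ₂ G (u≢v ∘ sym)))

  degenerate : Degenerate (adj G) (2 + Δ₂ G)
  degenerate S (w , w∈S) =
    let v , v∈S , v-min = ∃-argmin (_∈ₛ? S) (λ x → ∣ S ∩ behindSet x ∣) w∈S
    in v , v∈S , few-neighbours v-min (nonempty? (S ∩ neighbours (adj G) v))

lemma4p3 : (G : CircularIntervalGraph) → ListChromaticAtMost G (Δ₂ G + 3)
lemma4p3 G = Δ₂ G + 3 , ≤-refl , λ L L-unique L-length →
  degenerate⇒choosable (adj-irrefl G) (adj-sym G) L L-unique
    (λ v → trans (L-length v) (+-comm (Δ₂ G) 3)) (degenerate G)
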